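{- Let $m$ be an odd positive integer, $n\ge 1$, $\Sigma_m=\{0,\dots,m-1\}$, and $b\colon\Sigma_m^{n-1}\to\{0,1\}$ any function. Let $f_b\colon\Sigma_m^n\to\Sigma_m^n$ be $f_b(x_1,\dots,x_n)=(x_2,\dots,x_n,\,x_1+b(x_2,\dots,x_n)\bmod m)$ and $\sigma(x_1,\dots,x_n)=(x_2,\dots,x_n,x_1)$. Then, as permutations of $\Sigma_m^n$, $\operatorname{sgn}(f_b)=\operatorname{sgn}(\sigma)$. -}

module Defs where

open import Data.Nat.Base using (ℕ; zero; suc; _+_; _*_; _^_; _<ᵇ_; _%_; NonZero)
open import Data.Nat.DivMod using (_mod_)
open import Data.Fin.Base using (Fin; toℕ)
open import Data.Vec.Base using (Vec; []; _∷_; _∷ʳ_)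
open import Data.List.Base using (List; []; _∷_; [_]; map; concatMap; filterᵇ; length; allFin)
open import Data.Bool.Base using (Bool; true; false; if_then_else_)
open import Data.Sign.Base as S using (Sign)

Word : ℕ → ℕ → Set
Word m n = Vec (Fin m) n

allWords : (m n : ℕ) → List (Word m n)
allWords m zero    = [ [] ]
allWords m (suc n) = concatMap (λ i → map (i ∷_) (allWords m n)) (allFin m)

-- Base-m value of a word (first letter most significant); induces the
-- lexicographic total order on Σ_m^n.
value : {m n : ℕ} → Word m n → ℕ
value {m} {zero}  []       = 0
value {m} {suc n} (x ∷ xs) = (toℕ x * (m ^ n)) + value xs

inversionsOf : {m n : ℕ} → (Word m n → Word m n) → List (Word m n) → ℕ
inversionsOf f []       = 0
inversionsOf f (u ∷ us) =
  length (filterᵇ (λ v → value (f v) <ᵇ value (f u)) us) + inversionsOf f us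

parityToSign : ℕ → Sign
parityToSign zero          = S.+
parityToSign (suc zero)    = S.-
parityToSign (suc (suc k)) = parityToSign k

sgn : {m n : ℕ} → (Word m n → Word m n) → Sign
sgn {m} {n} f = parityToSign (inversionsOf f (allWords m n))

bit : Bool → ℕ
bit false = 0
bit true  = 1

fb : {m k : ℕ} .{{_ : NonZero m}} → (Word m k → Bool) → Word m (suc k) → Word m (suc k)
fb {m} b (x₁ ∷ xs) = xs ∷ʳ ((toℕ x₁ + bit (b xs)) mod m)

σ : {m k : ℕ} → Word m (suc k) → Word m (suc k)
σ (x₁ ∷ xs) = xs ∷ʳ x₁

{-# OPTIONS --safe #-}
-- List Σ_m^{k+1} lexicographically, i.e. as m blocks i ∷ Σ_m^k, each in
-- lexicographic order.  If f(i ∷ x) = x ∷ʳ ρ i x, the base-m value of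
-- f(i ∷ x) is (value x) * m + ρ i x.  So f has no inversion inside a block, and two
-- blocks i < j contribute one inversion per pair of distinct words of Σ_m^k
-- plus one per word w with ρ j w < ρ i w.  Hence
--   inv f = (a constant independent of ρ) + Σ_w inv (ρ · w).
-- For σ every ρ · w is the identity of Σ_m; for f_b it is the rotation
-- i ↦ i + b w, which has b w * (m - 1) inversions.  As m - 1 is even, the
-- two inversion counts have the same parity.
module Submission where

open import Defs
open import Algebra.Properties.CommutativeSemigroup using (interchange)
open import Data.Bool.Base using (Bool; true; false)
open import Data.Fin.Base as Fin using (Fin; toℕ; fromℕ; inject₁)
open import Data.Fin.Properties using (toℕ<n; toℕ-fromℕ; toℕ-fromℕ<; toℕ-inject₁)
open import Data.List.Base using (List; []; _∷_; [_]; _++_; _∷ʳ_; map; concatMap; filterᵇ; length; tabulate; allFin)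
open import Data.List.Properties using (length-tabulate)
open import Data.List.Relation.Unary.All as All using (All; []; _∷_)
import Data.List.Relation.Unary.All.Properties as All
open import Data.List.Relation.Unary.AllPairs as AllPairs using (AllPairs; []; _∷_)
import Data.List.Relation.Unary.AllPairs.Properties as AllPairs
open import Data.Nat.Base using (ℕ; zero; suc; _+_; _*_; _^_; _<ᵇ_; _%_; _/_; _<_; _≤_; z≤n; s≤s; NonZero)
open import Data.Nat.DivMod using (_mod_; m≡m%n+[m/n]*n; n%n≡0; m<n⇒m%n≡m; m%n<n)
open import Data.Nat.Properties
open import Data.Nat.Tactic.RingSolver using (solve-∀)
open import Data.Vec.Base as Vec using ([]; _∷_)
open import Function.Base using (_∘_; id)
open import Relation.Binary.PropositionalEquality using (_≡_; refl; sym; trans; cong; cong₂; subst₂; module ≡-Reasoning)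

private
  variable
    A B : Set

∑ : List A → (A → ℕ) → ℕ
∑ []       f = 0
∑ (x ∷ xs) f = f x + ∑ xs f

-- Binds tighter than _+_ and _*_: ∑[ x ∈ xs ] f x + c is (∑[ x ∈ xs ] f x) + c.
syntax ∑ xs (λ x → e) = ∑[ x ∈ xs ] e

pairSum : List A → (A → A → ℕ) → ℕ
pairSum []       φ = 0
pairSum (x ∷ xs) φ = ∑[ y ∈ xs ] φ x y + pairSum xs φ

inversions : (A → ℕ) → List A → ℕ
inversions key xs = pairSum xs (λ x y → bit (key y <ᵇ key x))

∑-cong : {f g : A → ℕ} → (∀ x → f x ≡ g x) → (xs : List A) → ∑ xs f ≡ ∑ xs g
∑-cong f≗g []       = refl
∑-cong f≗g (x ∷ xs) = cong₂ _+_ (f≗g x) (∑-cong f≗g xs)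

∑-congAll : {f g : A → ℕ} {xs : List A} → All (λ x → f x ≡ g x) xs → ∑ xs f ≡ ∑ xs g
∑-congAll []         = refl
∑-congAll (fx≡gx ∷ ps) = cong₂ _+_ fx≡gx (∑-congAll ps)

∑-zero : (xs : List A) → ∑[ x ∈ xs ] 0 ≡ 0
∑-zero []       = refl
∑-zero (x ∷ xs) = ∑-zero xs

∑-one : (xs : List A) → ∑[ x ∈ xs ] 1 ≡ length xs
∑-one []       = refl
∑-one (x ∷ xs) = cong suc (∑-one xs)

∑-distrib-+ : (f g : A → ℕ) (xs : List A) → ∑[ x ∈ xs ] (f x + g x) ≡ ∑ xs f + ∑ xs g
∑-distrib-+ f g []       = refl
∑-distrib-+ f g (x ∷ xs) =
  trans (cong (f x + g x +_) (∑-distrib-+ f g xs))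
        (interchange +-commutativeSemigroup (f x) (g x) (∑ xs f) (∑ xs g))

∑-*ʳ : (f : A → ℕ) (c : ℕ) (xs : List A) → ∑[ x ∈ xs ] (f x * c) ≡ ∑ xs f * c
∑-*ʳ f c []       = refl
∑-*ʳ f c (x ∷ xs) = trans (cong (f x * c +_) (∑-*ʳ f c xs)) (sym (*-distribʳ-+ c (f x) (∑ xs f)))

∑-++ : (xs ys : List A) (f : A → ℕ) → ∑ (xs ++ ys) f ≡ ∑ xs f + ∑ ys f
∑-++ []       ys f = refl
∑-++ (x ∷ xs) ys f = trans (cong (f x +_) (∑-++ xs ys f)) (sym (+-assoc (f x) _ _))

∑-map : (g : A → B) (xs : List A) (f : B → ℕ) → ∑ (map g xs) f ≡ ∑[ x ∈ xs ] f (g x)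
∑-map g []       f = refl
∑-map g (x ∷ xs) f = cong (f (g x) +_) (∑-map g xs f)

∑-concatMap : (G : B → List A) (is : List B) (f : A → ℕ) →
              ∑ (concatMap G is) f ≡ ∑[ i ∈ is ] ∑ (G i) f
∑-concatMap G []       f = refl
∑-concatMap G (i ∷ is) f = trans (∑-++ (G i) (concatMap G is) f) (cong (∑ (G i) f +_) (∑-concatMap G is f))

∑-comm : (xs : List A) (ys : List B) (φ : A → B → ℕ) →
         ∑[ x ∈ xs ] ∑[ y ∈ ys ] φ x y ≡ ∑[ y ∈ ys ] ∑[ x ∈ xs ] φ x y
∑-comm []       ys φ = sym (∑-zero ys)
∑-comm (x ∷ xs) ys φ =
  trans (cong (∑ ys (φ x) +_) (∑-comm xs ys φ))
        (sym (∑-distrib-+ (φ x) (λ y → ∑[ x ∈ xs ] φ x y) ys))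

pairSum-cong : {φ ψ : A → A → ℕ} → (∀ x y → φ x y ≡ ψ x y) → (xs : List A) →
               pairSum xs φ ≡ pairSum xs ψ
pairSum-cong φ≗ψ []       = refl
pairSum-cong φ≗ψ (x ∷ xs) = cong₂ _+_ (∑-cong (φ≗ψ x) xs) (pairSum-cong φ≗ψ xs)

pairSum-congAllPairs : {φ ψ : A → A → ℕ} {xs : List A} →
                       AllPairs (λ x y → φ x y ≡ ψ x y) xs → pairSum xs φ ≡ pairSum xs ψ
pairSum-congAllPairs []         = refl
pairSum-congAllPairs (px ∷ pxs) = cong₂ _+_ (∑-congAll px) (pairSum-congAllPairs pxs)

pairSum-zero : (xs : List A) → pairSum xs (λ _ _ → 0) ≡ 0
pairSum-zero []       = refl
pairSum-zero (x ∷ xs) = trans (cong (_+ pairSum xs _) (∑-zero xs)) (pairSum-zero xs)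

pairSum-distrib-+ : (φ ψ : A → A → ℕ) (xs : List A) →
                    pairSum xs (λ x y → φ x y + ψ x y) ≡ pairSum xs φ + pairSum xs ψ
pairSum-distrib-+ φ ψ []       = refl
pairSum-distrib-+ φ ψ (x ∷ xs) =
  trans (cong₂ _+_ (∑-distrib-+ (φ x) (ψ x) xs) (pairSum-distrib-+ φ ψ xs))
        (interchange +-commutativeSemigroup (∑ xs (φ x)) (∑ xs (ψ x)) (pairSum xs φ) (pairSum xs ψ))

pairSum-∑-comm : (xs : List A) (ys : List B) (φ : A → A → B → ℕ) →
                 pairSum xs (λ x x′ → ∑[ y ∈ ys ] φ x x′ y) ≡
                 ∑[ y ∈ ys ] pairSum xs (λ x x′ → φ x x′ y)
pairSum-∑-comm []       ys φ = sym (∑-zero ys)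
pairSum-∑-comm (x ∷ xs) ys φ =
  trans (cong₂ _+_ (∑-comm xs ys (φ x)) (pairSum-∑-comm xs ys φ))
        (sym (∑-distrib-+ (λ y → ∑[ x′ ∈ xs ] φ x x′ y)
                          (λ y → pairSum xs (λ x x′ → φ x x′ y)) ys))

pairSum-++ : (xs ys : List A) (φ : A → A → ℕ) →
             pairSum (xs ++ ys) φ ≡ pairSum xs φ + ∑[ x ∈ xs ] ∑[ y ∈ ys ] φ x y + pairSum ys φ
pairSum-++ []       ys φ = refl
pairSum-++ (x ∷ xs) ys φ =
  trans (cong₂ _+_ (∑-++ xs ys (φ x)) (pairSum-++ xs ys φ))
        (regroup (∑ xs (φ x)) (∑ ys (φ x)) (pairSum xs φ) (∑[ x ∈ xs ] ∑ ys (φ x)) (pairSum ys φ))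
  where
  regroup : ∀ a b c d e → a + b + (c + d + e) ≡ a + c + (b + d) + e
  regroup = solve-∀

pairSum-concatMap : (G : B → List A) (is : List B) (φ : A → A → ℕ) →
                    pairSum (concatMap G is) φ ≡
                    ∑[ i ∈ is ] pairSum (G i) φ + pairSum is (λ i j → ∑[ x ∈ G i ] ∑[ y ∈ G j ] φ x y)
pairSum-concatMap G []       φ = refl
pairSum-concatMap G (i ∷ is) φ =
  trans (pairSum-++ (G i) (concatMap G is) φ)
        (trans (cong₂ (λ s t → pairSum (G i) φ + s + t) cross (pairSum-concatMap G is φ))
               (regroup (pairSum (G i) φ) _ (∑[ j ∈ is ] pairSum (G j) φ) _))
  where
  cross : ∑[ x ∈ G i ] ∑[ y ∈ concatMap G is ] φ x y ≡ ∑[ j ∈ is ] ∑[ x ∈ G i ] ∑[ y ∈ G j ] φ x y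
  cross = begin
    ∑[ x ∈ G i ] ∑[ y ∈ concatMap G is ] φ x y ≡⟨ ∑-comm (G i) (concatMap G is) φ ⟩
    ∑[ y ∈ concatMap G is ] ∑[ x ∈ G i ] φ x y ≡⟨ ∑-concatMap G is _ ⟩
    ∑[ j ∈ is ] ∑[ y ∈ G j ] ∑[ x ∈ G i ] φ x y ≡⟨ ∑-cong (λ j → ∑-comm (G j) (G i) (λ y x → φ x y)) is ⟩
    ∑[ j ∈ is ] ∑[ x ∈ G i ] ∑[ y ∈ G j ] φ x y ∎
    where open ≡-Reasoning

  regroup : ∀ a b c d → a + b + (c + d) ≡ a + c + (b + d)
  regroup = solve-∀

∑∑-split : (xs : List A) (ψ : A → A → ℕ) →
           ∑[ x ∈ xs ] ∑[ y ∈ xs ] ψ x y ≡ ∑[ x ∈ xs ] ψ x x + pairSum xs ψ + pairSum xs (λ x y → ψ y x)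
∑∑-split []       ψ = refl
∑∑-split (x ∷ xs) ψ =
  trans (cong (ψ x x + ∑ xs (ψ x) +_)
              (trans (∑-distrib-+ (λ x′ → ψ x′ x) (λ x′ → ∑ xs (ψ x′)) xs)
                     (cong (∑[ x′ ∈ xs ] ψ x′ x +_) (∑∑-split xs ψ))))
        (regroup (ψ x x) (∑ xs (ψ x)) (∑[ x′ ∈ xs ] ψ x′ x) (∑[ x′ ∈ xs ] ψ x′ x′)
                 (pairSum xs ψ) (pairSum xs (λ x y → ψ y x)))
  where
  regroup : ∀ p a b d q r → p + a + (b + (d + q + r)) ≡ p + d + (a + q) + (b + r)
  regroup = solve-∀

≥⇒<ᵇ≡false : ∀ {m n} → n ≤ m → (m <ᵇ n) ≡ false
≥⇒<ᵇ≡false z≤n       = refl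
≥⇒<ᵇ≡false (s≤s n≤m) = ≥⇒<ᵇ≡false n≤m

<⇒<ᵇ≡true : ∀ {m n} → m < n → (m <ᵇ n) ≡ true
<⇒<ᵇ≡true {zero}  (s≤s _)   = refl
<⇒<ᵇ≡true {suc m} (s≤s m<n) = <⇒<ᵇ≡true m<n

+-cancelˡ-<ᵇ : ∀ c m n → (c + m <ᵇ c + n) ≡ (m <ᵇ n)
+-cancelˡ-<ᵇ zero    m n = refl
+-cancelˡ-<ᵇ (suc c) m n = +-cancelˡ-<ᵇ c m n

length-filterᵇ : (p : A → Bool) (xs : List A) → length (filterᵇ p xs) ≡ ∑[ x ∈ xs ] bit (p x)
length-filterᵇ p []       = refl
length-filterᵇ p (x ∷ xs) with p x
... | true  = cong suc (length-filterᵇ p xs)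
... | false = length-filterᵇ p xs

inversionsOf≡inversions : ∀ {m n} (f : Word m n → Word m n) (xs : List (Word m n)) →
                          inversionsOf f xs ≡ inversions (value ∘ f) xs
inversionsOf≡inversions f []       = refl
inversionsOf≡inversions f (u ∷ us) =
  cong₂ _+_ (length-filterᵇ (λ v → value (f v) <ᵇ value (f u)) us) (inversionsOf≡inversions f us)

inversions-cong : {key key′ : A → ℕ} → (∀ x → key x ≡ key′ x) → (xs : List A) →
                  inversions key xs ≡ inversions key′ xs
inversions-cong key≗key′ = pairSum-cong (λ x y → cong bit (cong₂ _<ᵇ_ (key≗key′ y) (key≗key′ x)))

inversions-sorted : {key : A → ℕ} {xs : List A} →
                    AllPairs (λ x y → key x ≤ key y) xs → inversions key xs ≡ 0
inversions-sorted {xs = xs} sorted =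
  trans (pairSum-congAllPairs (AllPairs.map (cong bit ∘ ≥⇒<ᵇ≡false) sorted)) (pairSum-zero xs)

lex-< : ∀ {M a c r} → r < M → a < c → a * M + r < c * M
lex-< {M} {a} {c} {r} r<M a<c = begin-strict
  a * M + r   <⟨ +-monoʳ-< (a * M) r<M ⟩
  a * M + M   ≡⟨ +-comm (a * M) M ⟩
  suc a * M   ≤⟨ *-monoˡ-≤ M a<c ⟩
  c * M       ∎
  where open ≤-Reasoning

value-< : ∀ {m n} (xs : Word m n) → value xs < m ^ n
value-< []       = s≤s z≤n
value-< (x ∷ xs) = lex-< (value-< xs) (toℕ<n x)

value-∷ʳ : ∀ {m n} (xs : Word m n) (a : Fin m) → value (xs Vec.∷ʳ a) ≡ value xs * m + toℕ a
value-∷ʳ []       a = trans (+-identityʳ _) (*-identityʳ (toℕ a))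
value-∷ʳ {m} {suc n} (x ∷ xs) a =
  trans (cong (toℕ x * (m * m ^ n) +_) (value-∷ʳ xs a)) (regroup (toℕ x) m (m ^ n) (value xs) (toℕ a))
  where
  regroup : ∀ x m p v a → x * (m * p) + (v * m + a) ≡ (x * p + v) * m + a
  regroup = solve-∀

value-∷ʳ-< : ∀ {m n} {u v : Word m n} (a b : Fin m) → value u < value v →
             value (u Vec.∷ʳ a) < value (v Vec.∷ʳ b)
value-∷ʳ-< {u = u} {v} a b u<v =
  subst₂ _<_ (sym (value-∷ʳ u a)) (sym (value-∷ʳ v b)) (<-≤-trans (lex-< (toℕ<n a) u<v) (m≤m+n _ _))

allWords-sorted : ∀ m k → AllPairs (λ u v → value u < value v) (allWords m k)
allWords-sorted m zero    = [] ∷ []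
allWords-sorted m (suc k) = AllPairs.concat⁺ blocks-sorted blocks-ordered
  where
  W : List (Word m k)
  W = allWords m k

  blocks-sorted : All (AllPairs (λ u v → value u < value v)) (map (λ i → map (i ∷_) W) (allFin m))
  blocks-sorted = All.map⁺ (All.universal
    (λ i → AllPairs.map⁺ (AllPairs.map (+-monoʳ-< (toℕ i * m ^ k)) (allWords-sorted m k))) (allFin m))

  blocks-ordered : AllPairs (λ us vs → All (λ u → All (λ v → value u < value v) vs) us)
                            (map (λ i → map (i ∷_) W) (allFin m))
  blocks-ordered = AllPairs.map⁺ (AllPairs.tabulate⁺-< (λ i<j →
    All.map⁺ (All.universal (λ u →
      All.map⁺ (All.universal (λ v → <-≤-trans (lex-< (value-< u) i<j) (m≤m+n _ _)) W)) W)))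

toℕ-mod : ∀ x m .{{_ : NonZero m}} → toℕ (x mod m) ≡ x % m
toℕ-mod x m = toℕ-fromℕ< (m%n<n x m)

tabulate-∷ʳ : ∀ n (f : Fin (suc n) → A) → tabulate f ≡ tabulate (f ∘ inject₁) ∷ʳ f (fromℕ n)
tabulate-∷ʳ zero    f = refl
tabulate-∷ʳ (suc n) f = cong (f Fin.zero ∷_) (tabulate-∷ʳ n (f ∘ Fin.suc))

inversions-toℕ : ∀ n → inversions toℕ (allFin n) ≡ 0
inversions-toℕ n = inversions-sorted {key = toℕ} (AllPairs.tabulate⁺-< {n = n} {f = id} <⇒≤)

inversions-rotate-one : ∀ n → inversions (λ i → toℕ ((toℕ i + 1) mod suc n)) (allFin (suc n)) ≡ n
inversions-rotate-one n = begin
  inversions key (allFin (suc n))                                 ≡⟨ cong (inversions key) (tabulate-∷ʳ n id) ⟩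
  inversions key (I ∷ʳ fromℕ n)                                   ≡⟨ pairSum-++ I [ fromℕ n ] _ ⟩
  inversions key I + ∑[ i ∈ I ] (bit (key (fromℕ n) <ᵇ key i) + 0) + 0
    ≡⟨ cong₂ (λ s t → s + t + 0) (inversions-sorted I-sorted) (∑-congAll (All.tabulate⁺ last-below)) ⟩
  ∑[ i ∈ I ] 1 + 0                                                ≡⟨ +-identityʳ _ ⟩
  ∑[ i ∈ I ] 1                                                    ≡⟨ ∑-one I ⟩
  length I                                                        ≡⟨ length-tabulate inject₁ ⟩
  n                                                               ∎
  where
  open ≡-Reasoning

  key : Fin (suc n) → ℕ
  key i = toℕ ((toℕ i + 1) mod suc n)

  I : List (Fin (suc n))
  I = tabulate inject₁

  key-inject₁ : ∀ i → key (inject₁ i) ≡ suc (toℕ i)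
  key-inject₁ i = begin
    toℕ ((toℕ (inject₁ i) + 1) mod suc n) ≡⟨ toℕ-mod (toℕ (inject₁ i) + 1) (suc n) ⟩
    (toℕ (inject₁ i) + 1) % suc n         ≡⟨ cong (λ x → (x + 1) % suc n) (toℕ-inject₁ i) ⟩
    (toℕ i + 1) % suc n                   ≡⟨ cong (_% suc n) (+-comm (toℕ i) 1) ⟩
    suc (toℕ i) % suc n                   ≡⟨ m<n⇒m%n≡m (s≤s (toℕ<n i)) ⟩
    suc (toℕ i)                           ∎

  key-fromℕ : key (fromℕ n) ≡ 0
  key-fromℕ = begin
    toℕ ((toℕ (fromℕ n) + 1) mod suc n) ≡⟨ toℕ-mod (toℕ (fromℕ n) + 1) (suc n) ⟩
    (toℕ (fromℕ n) + 1) % suc n         ≡⟨ cong (λ x → (x + 1) % suc n) (toℕ-fromℕ n) ⟩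
    (n + 1) % suc n                     ≡⟨ cong (_% suc n) (+-comm n 1) ⟩
    suc n % suc n                       ≡⟨ n%n≡0 (suc n) ⟩
    0                                   ∎

  I-sorted : AllPairs (λ i j → key i ≤ key j) I
  I-sorted = AllPairs.tabulate⁺-< (λ {i} {j} i<j →
    subst₂ _≤_ (sym (key-inject₁ i)) (sym (key-inject₁ j)) (s≤s (<⇒≤ i<j)))

  last-below : ∀ i → bit (key (fromℕ n) <ᵇ key (inject₁ i)) + 0 ≡ 1
  last-below i = cong₂ (λ a b → bit (a <ᵇ b) + 0) key-fromℕ (key-inject₁ i)

inversions-rotate : ∀ n β → inversions (λ i → toℕ ((toℕ i + bit β) mod suc n)) (allFin (suc n)) ≡ bit β * n
inversions-rotate n false = trans (inversions-cong key≡toℕ (allFin (suc n))) (inversions-toℕ (suc n))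
  where
  key≡toℕ : ∀ i → toℕ ((toℕ i + 0) mod suc n) ≡ toℕ i
  key≡toℕ i = trans (toℕ-mod (toℕ i + 0) (suc n))
                    (trans (cong (_% suc n) (+-identityʳ (toℕ i))) (m<n⇒m%n≡m (toℕ<n i)))
inversions-rotate n true  = trans (inversions-rotate-one n) (sym (+-identityʳ n))

inversionsOf-shift : ∀ {m k} (f : Word m (suc k) → Word m (suc k)) (ρ : Fin m → Word m k → Fin m) →
                     (∀ i x → f (i ∷ x) ≡ x Vec.∷ʳ ρ i x) →
                     inversionsOf f (allWords m (suc k)) ≡
                     ∑[ w ∈ allWords m k ] inversions (λ i → toℕ (ρ i w)) (allFin m)
                       + pairSum (allFin m) (λ _ _ → pairSum (allWords m k) (λ _ _ → 1))
inversionsOf-shift {m} {k} f ρ f-∷ = begin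
  inversionsOf f (concatMap block (allFin m))
    ≡⟨ inversionsOf≡inversions f (concatMap block (allFin m)) ⟩
  pairSum (concatMap block (allFin m)) φ
    ≡⟨ pairSum-concatMap block (allFin m) φ ⟩
  ∑[ i ∈ allFin m ] inversions key (block i)
    + pairSum (allFin m) (λ i j → ∑[ x ∈ block i ] ∑[ y ∈ block j ] φ x y)
    ≡⟨ cong₂ _+_ (trans (∑-cong block-sorted (allFin m)) (∑-zero (allFin m)))
                 (pairSum-cong between-blocks (allFin m)) ⟩
  pairSum (allFin m) (λ i j → ∑[ w ∈ W ] ρ-inverted i j w + P)
    ≡⟨ pairSum-distrib-+ (λ i j → ∑[ w ∈ W ] ρ-inverted i j w) (λ _ _ → P) (allFin m) ⟩
  pairSum (allFin m) (λ i j → ∑[ w ∈ W ] ρ-inverted i j w) + pairSum (allFin m) (λ _ _ → P)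
    ≡⟨ cong (_+ pairSum (allFin m) (λ _ _ → P)) (pairSum-∑-comm (allFin m) W ρ-inverted) ⟩
  ∑[ w ∈ W ] inversions (λ i → toℕ (ρ i w)) (allFin m) + pairSum (allFin m) (λ _ _ → P)
    ∎
  where
  open ≡-Reasoning

  W : List (Word m k)
  W = allWords m k

  P : ℕ
  P = pairSum W (λ _ _ → 1)

  block : Fin m → List (Word m (suc k))
  block i = map (i ∷_) W

  key : Word m (suc k) → ℕ
  key = value ∘ f

  φ : Word m (suc k) → Word m (suc k) → ℕ
  φ x y = bit (key y <ᵇ key x)

  ρ-inverted : Fin m → Fin m → Word m k → ℕ
  ρ-inverted i j w = bit (toℕ (ρ j w) <ᵇ toℕ (ρ i w))

  key-∷ : ∀ i x → key (i ∷ x) ≡ value x * m + toℕ (ρ i x)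
  key-∷ i x = trans (cong value (f-∷ i x)) (value-∷ʳ x (ρ i x))

  key-< : ∀ {u v} i j → value u < value v → key (i ∷ u) < key (j ∷ v)
  key-< {u} {v} i j u<v =
    subst₂ _<_ (cong value (sym (f-∷ i u))) (cong value (sym (f-∷ j v)))
               (value-∷ʳ-< {u = u} {v} (ρ i u) (ρ j v) u<v)

  block-sorted : ∀ i → inversions key (block i) ≡ 0
  block-sorted i =
    inversions-sorted {key = key} (AllPairs.map⁺ (AllPairs.map (<⇒≤ ∘ key-< i i) (allWords-sorted m k)))

  -- For u ≠ v, f inverts (i ∷ u, j ∷ v) iff v precedes u, whatever ρ is; only u = v involves ρ.
  between-blocks : ∀ i j → ∑[ x ∈ block i ] ∑[ y ∈ block j ] φ x y ≡ ∑[ w ∈ W ] ρ-inverted i j w + P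
  between-blocks i j = begin
    ∑[ x ∈ block i ] ∑[ y ∈ block j ] φ x y
      ≡⟨ trans (∑-map (i ∷_) W _) (∑-cong (λ u → ∑-map (j ∷_) W (φ (i ∷ u))) W) ⟩
    ∑[ u ∈ W ] ∑[ v ∈ W ] φ (i ∷ u) (j ∷ v)
      ≡⟨ ∑∑-split W (λ u v → φ (i ∷ u) (j ∷ v)) ⟩
    ∑[ u ∈ W ] φ (i ∷ u) (j ∷ u) + pairSum W (λ u v → φ (i ∷ u) (j ∷ v))
      + pairSum W (λ u v → φ (i ∷ v) (j ∷ u))
      ≡⟨ cong₂ _+_ (cong₂ _+_ (∑-cong diagonal W)
                              (trans (pairSum-congAllPairs (AllPairs.map earlier-first sorted)) (pairSum-zero W)))
                   (pairSum-congAllPairs (AllPairs.map later-first sorted)) ⟩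
    ∑[ w ∈ W ] ρ-inverted i j w + 0 + P
      ≡⟨ cong (_+ P) (+-identityʳ _) ⟩
    ∑[ w ∈ W ] ρ-inverted i j w + P
      ∎
    where
    sorted : AllPairs (λ u v → value u < value v) W
    sorted = allWords-sorted m k

    diagonal : ∀ w → φ (i ∷ w) (j ∷ w) ≡ ρ-inverted i j w
    diagonal w = cong bit (trans (cong₂ _<ᵇ_ (key-∷ j w) (key-∷ i w)) (+-cancelˡ-<ᵇ (value w * m) _ _))

    earlier-first : ∀ {u v} → value u < value v → φ (i ∷ u) (j ∷ v) ≡ 0
    earlier-first u<v = cong bit (≥⇒<ᵇ≡false (<⇒≤ (key-< i j u<v)))

    later-first : ∀ {u v} → value u < value v → φ (i ∷ v) (j ∷ u) ≡ 1
    later-first u<v = cong bit (<⇒<ᵇ≡true (key-< j i u<v))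

parityToSign-*2+ : ∀ t c → parityToSign (t * 2 + c) ≡ parityToSign c
parityToSign-*2+ zero    c = refl
parityToSign-*2+ (suc t) c = parityToSign-*2+ t c

corollary4p2 : (m k : ℕ) .{{_ : NonZero m}} → m % 2 ≡ 1 →
    (b : Word m k → Bool) →
    sgn {m} {suc k} (fb b) ≡ sgn {m} {suc k} σ
corollary4p2 zero        k () b
corollary4p2 m@(suc n) k m-odd b = begin
  sgn {m} {suc k} (fb b)
    ≡⟨ cong parityToSign (inversionsOf-shift {m} {k} (fb b) rotation (λ _ _ → refl)) ⟩
  parityToSign (∑[ w ∈ W ] inversions (λ i → toℕ (rotation i w)) (allFin m) + C)
    ≡⟨ cong (λ s → parityToSign (s + C)) rotations ⟩
  parityToSign (S * n + C)
    ≡⟨ cong (λ s → parityToSign (s + C)) (trans (cong (S *_) n-even) (sym (*-assoc S (m / 2) 2))) ⟩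
  parityToSign (S * (m / 2) * 2 + C)
    ≡⟨ parityToSign-*2+ (S * (m / 2)) C ⟩
  parityToSign C
    ≡⟨ cong (λ s → parityToSign (s + C)) (trans (∑-cong (λ _ → inversions-toℕ m) W) (∑-zero W)) ⟨
  parityToSign (∑[ w ∈ W ] inversions toℕ (allFin m) + C)
    ≡⟨ cong parityToSign (inversionsOf-shift {m} {k} σ (λ i _ → i) (λ _ _ → refl)) ⟨
  sgn {m} {suc k} σ
    ∎
  where
  open ≡-Reasoning

  W : List (Word m k)
  W = allWords m k

  rotation : Fin m → Word m k → Fin m
  rotation i w = (toℕ i + bit (b w)) mod m

  C S : ℕ
  C = pairSum (allFin m) (λ _ _ → pairSum W (λ _ _ → 1))
  S = ∑[ w ∈ W ] bit (b w)

  rotations : ∑[ w ∈ W ] inversions (λ i → toℕ (rotation i w)) (allFin m) ≡ S * n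
  rotations = trans (∑-cong (λ w → inversions-rotate n (b w)) W) (∑-*ʳ (bit ∘ b) n W)

  n-even : n ≡ m / 2 * 2
  n-even = suc-injective (trans (m≡m%n+[m/n]*n m 2) (cong (_+ m / 2 * 2) m-odd))
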